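{- Let $(x,y,z,w)\in\mathbb R^4$ be a Descartes quadruple with $x+y+z+w>0$, and let $i\in\{1,2,3,4\}$ be such that the $i$-th coordinate is not maximal (it is strictly smaller than the largest of $x,y,z,w$). Let $S_{ii}=S_i^\perp S_i$. Then $S_{ii}(x,y,z,w)^t$ is, possibly after reordering its coordinates, a root quadruple.
   Context: A Descartes quadruple is a vector $(y_0,y_1,y_2,y_3)$ with $(y_0+y_1+y_2+y_3)^2-2(y_0^2+y_1^2+y_2^2+y_3^2)=0$. It is a root quadruple if, after reordering its coordinates as $(a,b,c,d)$, $a\le0\le b\le c\le d$ and $a+b+c\ge d$. Matrices: $S_1=\begin{pmatrix}-1&2&2&2\\0&1&0&0\\0&0&1&0\\0&0&0&1\end{pmatrix}$, $S_2=\begin{pmatrix}1&0&0&0\\2&-1&2&2\\0&0&1&0\\0&0&0&1\end{pmatrix}$, $S_3=\begin{pmatrix}1&0&0&0\\0&1&0&0\\2&2&-1&2\\0&0&0&1\end{pmatrix}$, $S_4=\begin{pmatrix}1&0&0&0\\0&1&0&0\\0&0&1&0\\2&2&2&-1\end{pmatrix}$, $S_1^\perp=\begin{pmatrix}-1&0&0&0\\2&1&0&0\\2&0&1&0\\2&0&0&1\end{pmatrix}$, $S_2^\perp=\begin{pmatrix}1&2&0&0\\0&-1&0&0\\0&2&1&0\\0&2&0&1\end{pmatrix}$, $S_3^\perp=\begin{pmatrix}1&0&2&0\\0&1&2&0\\0&0&-1&0\\0&0&2&1\end{pmatrix}$, $S_4^\perp=\begin{pmatrix}1&0&0&2\\0&1&0&2\\0&0&1&2\\0&0&0&-1\end{pmatrix}$.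 -}

module Defs where

open import Level using (Level; _⊔_) renaming (suc to lsuc)
open import Algebra.Bundles using (CommutativeRing)
open import Relation.Binary.Structures using (IsTotalOrder)
open import Relation.Nullary using (¬_)
open import Data.Fin using (Fin)
import Data.Fin as Fin
open import Data.Fin.Permutation using (Permutation′; _⟨$⟩ʳ_)
open import Data.Product using (Σ; ∃; _×_; _,_)
open import Data.Bool using (if_then_else_)
open import Relation.Nullary.Decidable using (⌊_⌋)
import Data.Fin.Properties as FinP

-- An ordered field (the paper works in ℝ; every statement below uses only
-- ordered-field structure, so we state it for an arbitrary ordered field).
record OrderedField (c ℓ₁ ℓ₂ : Level) : Set (lsuc (c ⊔ ℓ₁ ⊔ ℓ₂)) where
  field
    commutativeRing : CommutativeRing c ℓ₁
  open CommutativeRing commutativeRing public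
  field
    _≤_           : Carrier → Carrier → Set ℓ₂
    isTotalOrder  : IsTotalOrder _≈_ _≤_
    +-monoˡ-≤     : ∀ {x y} z → x ≤ y → (x + z) ≤ (y + z)
    *-nonneg      : ∀ {x y} → 0# ≤ x → 0# ≤ y → 0# ≤ (x * y)
    0≉1           : ¬ (0# ≈ 1#)
    _⁻¹           : Carrier → Carrier
    ⁻¹-inverse    : ∀ x → ¬ (x ≈ 0#) → (x * (x ⁻¹)) ≈ 1#

  _<_ : Carrier → Carrier → Set (ℓ₁ ⊔ ℓ₂)
  x < y = (x ≤ y) × ¬ (x ≈ y)

module OF {c ℓ₁ ℓ₂ : Level} (F : OrderedField c ℓ₁ ℓ₂) where
  open OrderedField F hiding (zero)

  2# : Carrier
  2# = 1# + 1#

  Vec4 : Set c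
  Vec4 = Fin 4 → Carrier

  Mat4 : Set c
  Mat4 = Fin 4 → Fin 4 → Carrier

  Σ4 : (Fin 4 → Carrier) → Carrier
  Σ4 f = f Fin.zero + f (Fin.suc Fin.zero) + f (Fin.suc (Fin.suc Fin.zero)) + f (Fin.suc (Fin.suc (Fin.suc Fin.zero)))

  _⊛_ : Mat4 → Vec4 → Vec4
  (M ⊛ v) j = Σ4 (λ k → M j k * v k)

  _⋆_ : Mat4 → Mat4 → Mat4
  (M ⋆ N) j l = Σ4 (λ k → M j k * N k l)

  δ : Fin 4 → Fin 4 → Carrier
  δ j k = if ⌊ j FinP.≟ k ⌋ then 1# else 0#

  S : Fin 4 → Mat4
  S i j k = if ⌊ j FinP.≟ i ⌋
              then (if ⌊ k FinP.≟ i ⌋ then - 1# else 2#)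
              else δ j k

  S⊥ : Fin 4 → Mat4
  S⊥ i j k = if ⌊ k FinP.≟ i ⌋
               then (if ⌊ j FinP.≟ i ⌋ then - 1# else 2#)
               else δ j k

  Sii : Fin 4 → Mat4
  Sii i = S⊥ i ⋆ S i

  sq : Carrier → Carrier
  sq a = a * a

  IsDescartes : Vec4 → Set ℓ₁
  IsDescartes y = (sq (Σ4 y) - 2# * Σ4 (λ k → sq (y k))) ≈ 0#

  IsRoot : Vec4 → Set (ℓ₂)
  IsRoot y = ∃ λ (σ : Permutation′ 4) →
    let a = y (σ ⟨$⟩ʳ Fin.zero)
        b = y (σ ⟨$⟩ʳ Fin.suc Fin.zero)
        c' = y (σ ⟨$⟩ʳ Fin.suc (Fin.suc Fin.zero))
        d = y (σ ⟨$⟩ʳ Fin.suc (Fin.suc (Fin.suc Fin.zero)))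
    in (a ≤ 0#) × (0# ≤ b) × (b ≤ c') × (c' ≤ d) × (d ≤ (a + b + c'))

-- S_i replaces the i-th coordinate x by X = 2(y + z + w) - x, where y ≤ z ≤ w are the other
-- coordinates, and S_i^⊥ then turns (X, y, z, w) into (-X, y + 2X, z + 2X, w + 2X). For a
-- Descartes quadruple (p, q, r, s) the identity
--   (p + r - q - s)² + (p + s - q - r)² = 4(p + q)(r + s) - 2 Q(p, q, r, s)
-- gives (p + q)(r + s) ≥ 0, hence (p + q)(p + q + r + s) ≥ 0, so every pair sum is nonnegative
-- once the total is positive. Together with x ≤ w (x is not maximal) this yields all root
-- inequalities; the last one reads (-X) + (y + 2X) + (z + 2X) - (w + 2X) = 3(y + z) + (w - x) ≥ 0.
module Submission where

open import Defs
open import Data.Fin using (Fin)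
open import Data.Product using (∃)

open import Algebra.Bundles using (CommutativeRing)
open import Data.Bool using (if_then_else_)
open import Data.Empty using (⊥-elim)
open import Data.Fin using (suc)
open import Data.Fin.Patterns using (0F; 1F; 2F; 3F)
open import Data.Fin.Permutation
  using (Permutation′; _⟨$⟩ʳ_; _⟨$⟩ˡ_; inverseˡ; inverseʳ; transpose; lift₀; id; _∘ₚ_)
import Data.Fin.Properties as FinP
open import Data.Integer as ℤ using (ℤ; +_; -[1+_]; _⊖_; sign; ∣_∣)
import Data.Integer.Properties as ℤP
open import Data.Maybe using (Maybe; just; nothing)
open import Data.Nat as ℕ using (zero; suc)
import Data.Nat.Properties as ℕP
open import Data.Product using (_×_; _,_; proj₁; proj₂)
open import Data.Sign as Sign using (Sign)
open import Data.Sum using (_⊎_; inj₁; inj₂)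
open import Data.Vec using (tabulate)
open import Relation.Binary.Core using (Rel)
open import Relation.Binary.Definitions using (Total)
open import Relation.Binary.PropositionalEquality as ≡ using (_≡_; _≢_)
open import Relation.Binary.Structures using (IsTotalOrder)
open import Relation.Nullary using (yes; no)
open import Relation.Nullary.Decidable using (⌊_⌋)

module IntegerRingSolver {c ℓ} (R : CommutativeRing c ℓ) where
  open CommutativeRing R
  open import Algebra.Properties.Semiring.Mult.TCOptimised semiring
    using (1+×; ×-homo-+; ×1-homo-*) renaming (_×_ to _×′_)
  open import Algebra.Properties.Ring ring using (-1*x≈-x)
  open import Algebra.Properties.AbelianGroup +-abelianGroup using (ε⁻¹≈ε; ⁻¹-involutive; ⁻¹-∙-comm)
  open import Algebra.Properties.CommutativeSemigroup +-commutativeSemigroup using (interchange)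
  open import Algebra.Properties.CommutativeSemigroup *-commutativeSemigroup
    using () renaming (interchange to *-interchange)
  open import Algebra.Solver.Ring.AlmostCommutativeRing using (fromCommutativeRing; _-Raw-AlmostCommutative⟶_)
  open import Relation.Binary.Reasoning.Setoid setoid

  -- The TC-optimised multiple _×′_ makes fromℤ (+ 1) and fromℤ (+ 2) reduce to 1# and
  -- 1# + 1#, so solver constants agree definitionally with the constants of Defs.
  fromℤ : ℤ → Carrier
  fromℤ (+ n)    = n ×′ 1#
  fromℤ -[1+ n ] = - (suc n ×′ 1#)

  fromℤ-⊖ : ∀ m n → fromℤ (m ⊖ n) ≈ m ×′ 1# - n ×′ 1#
  fromℤ-⊖ m       zero    = begin
    fromℤ (m ⊖ 0)  ≡⟨ ≡.cong fromℤ (ℤP.⊖-≥ {m} ℕ.z≤n) ⟩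
    m ×′ 1#        ≈⟨ +-identityʳ (m ×′ 1#) ⟨
    m ×′ 1# + 0#   ≈⟨ +-congˡ ε⁻¹≈ε ⟨
    m ×′ 1# - 0#   ∎
  fromℤ-⊖ zero    (suc n) = sym (+-identityˡ _)
  fromℤ-⊖ (suc m) (suc n) = begin
    fromℤ (suc m ⊖ suc n)              ≡⟨ ≡.cong fromℤ (ℤP.[1+m]⊖[1+n]≡m⊖n m n) ⟩
    fromℤ (m ⊖ n)                      ≈⟨ fromℤ-⊖ m n ⟩
    m ×′ 1# - n ×′ 1#                  ≈⟨ +-identityˡ _ ⟨
    0# + (m ×′ 1# - n ×′ 1#)           ≈⟨ +-congʳ (-‿inverseʳ 1#) ⟨
    (1# - 1#) + (m ×′ 1# - n ×′ 1#)    ≈⟨ interchange _ _ _ _ ⟩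
    (1# + m ×′ 1#) + (- 1# - n ×′ 1#)  ≈⟨ +-cong (sym (1+× m 1#)) (⁻¹-∙-comm 1# (n ×′ 1#)) ⟩
    suc m ×′ 1# - (1# + n ×′ 1#)       ≈⟨ +-congˡ (-‿cong (1+× n 1#)) ⟨
    suc m ×′ 1# - suc n ×′ 1#          ∎

  fromℤ-+ : ∀ i j → fromℤ (i ℤ.+ j) ≈ fromℤ i + fromℤ j
  fromℤ-+ (+ m)    (+ n)    = ×-homo-+ 1# m n
  fromℤ-+ (+ m)    -[1+ n ] = fromℤ-⊖ m (suc n)
  fromℤ-+ -[1+ m ] (+ n)    = trans (fromℤ-⊖ n (suc m)) (+-comm _ _)
  fromℤ-+ -[1+ m ] -[1+ n ] = begin
    - (suc (suc (m ℕ.+ n)) ×′ 1#)      ≡⟨ ≡.cong (λ k → - (k ×′ 1#)) (ℕP.+-suc (suc m) n) ⟨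
    - ((suc m ℕ.+ suc n) ×′ 1#)        ≈⟨ -‿cong (×-homo-+ 1# (suc m) (suc n)) ⟩
    - (suc m ×′ 1# + suc n ×′ 1#)      ≈⟨ ⁻¹-∙-comm _ _ ⟨
    - (suc m ×′ 1#) + - (suc n ×′ 1#)  ∎

  fromℤ-neg : ∀ i → fromℤ (ℤ.- i) ≈ - fromℤ i
  fromℤ-neg (+ zero)  = sym ε⁻¹≈ε
  fromℤ-neg (+ suc n) = refl
  fromℤ-neg -[1+ n ]  = sym (⁻¹-involutive _)

  fromSign : Sign → Carrier
  fromSign Sign.+ = 1#
  fromSign Sign.- = - 1#

  fromSign-* : ∀ s t → fromSign (s Sign.* t) ≈ fromSign s * fromSign t
  fromSign-* Sign.+ t      = sym (*-identityˡ _)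
  fromSign-* Sign.- Sign.+ = sym (*-identityʳ _)
  fromSign-* Sign.- Sign.- = sym (trans (-1*x≈-x (- 1#)) (⁻¹-involutive 1#))

  fromℤ-◃ : ∀ s n → fromℤ (s ℤ.◃ n) ≈ fromSign s * (n ×′ 1#)
  fromℤ-◃ s       zero    = sym (zeroʳ _)
  fromℤ-◃ Sign.+ (suc n) = sym (*-identityˡ _)
  fromℤ-◃ Sign.- (suc n) = sym (-1*x≈-x _)

  fromℤ≈sign*abs : ∀ i → fromℤ i ≈ fromSign (sign i) * (∣ i ∣ ×′ 1#)
  fromℤ≈sign*abs (+ n)    = sym (*-identityˡ _)
  fromℤ≈sign*abs -[1+ n ] = sym (-1*x≈-x _)

  fromℤ-* : ∀ i j → fromℤ (i ℤ.* j) ≈ fromℤ i * fromℤ j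
  fromℤ-* i j = begin
    fromℤ (sign i Sign.* sign j ℤ.◃ ∣ i ∣ ℕ.* ∣ j ∣)
      ≈⟨ fromℤ-◃ (sign i Sign.* sign j) (∣ i ∣ ℕ.* ∣ j ∣) ⟩
    fromSign (sign i Sign.* sign j) * ((∣ i ∣ ℕ.* ∣ j ∣) ×′ 1#)
      ≈⟨ *-cong (fromSign-* (sign i) (sign j)) (×1-homo-* ∣ i ∣ ∣ j ∣) ⟩
    (fromSign (sign i) * fromSign (sign j)) * (∣ i ∣ ×′ 1# * ∣ j ∣ ×′ 1#)
      ≈⟨ *-interchange _ _ _ _ ⟩
    (fromSign (sign i) * ∣ i ∣ ×′ 1#) * (fromSign (sign j) * ∣ j ∣ ×′ 1#)
      ≈⟨ *-cong (fromℤ≈sign*abs i) (fromℤ≈sign*abs j) ⟨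
    fromℤ i * fromℤ j
      ∎

  homomorphism : CommutativeRing.rawRing ℤP.+-*-commutativeRing -Raw-AlmostCommutative⟶ fromCommutativeRing R
  homomorphism = record
    { ⟦_⟧    = fromℤ
    ; +-homo = fromℤ-+
    ; *-homo = fromℤ-*
    ; -‿homo = fromℤ-neg
    ; 0-homo = refl
    ; 1-homo = refl
    }

  fromℤ-≟ : ∀ i j → Maybe (fromℤ i ≈ fromℤ j)
  fromℤ-≟ i j with i ℤ.≟ j
  ... | yes ≡.refl = just refl
  ... | no _       = nothing

  open import Algebra.Solver.Ring (CommutativeRing.rawRing ℤP.+-*-commutativeRing) (fromCommutativeRing R)
    homomorphism fromℤ-≟ public

sort₃ : ∀ {a r} {A : Set a} {_≤_ : Rel A r} → Total _≤_ → (f : Fin 3 → A) →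
        ∃ λ (ρ : Permutation′ 3) → f (ρ ⟨$⟩ʳ 0F) ≤ f (ρ ⟨$⟩ʳ 1F) × f (ρ ⟨$⟩ʳ 1F) ≤ f (ρ ⟨$⟩ʳ 2F)
sort₃ total f with total (f 0F) (f 1F)
... | inj₁ a≤b with total (f 1F) (f 2F)
...   | inj₁ b≤c = id , a≤b , b≤c
...   | inj₂ c≤b with total (f 0F) (f 2F)
...     | inj₁ a≤c = transpose 1F 2F , a≤c , c≤b
...     | inj₂ c≤a = transpose 0F 1F ∘ₚ transpose 1F 2F , c≤a , a≤b
sort₃ total f | inj₂ b≤a with total (f 0F) (f 2F)
...   | inj₁ a≤c = transpose 0F 1F , b≤a , a≤c
...   | inj₂ c≤a with total (f 1F) (f 2F)
...     | inj₁ b≤c = transpose 1F 2F ∘ₚ transpose 0F 1F , b≤c , c≤a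
...     | inj₂ c≤b = transpose 0F 2F , c≤b , b≤a

-- Integer copies of δ, S and S⊥: for concrete indices fromℤ of an entry reduces to the
-- corresponding entry over the field, so coordinates of Sii are computed by normalisation.
δℤ : Fin 4 → Fin 4 → ℤ
δℤ j k = if ⌊ j FinP.≟ k ⌋ then + 1 else + 0

Sℤ S⊥ℤ : Fin 4 → Fin 4 → Fin 4 → ℤ
Sℤ i j k = if ⌊ j FinP.≟ i ⌋ then (if ⌊ k FinP.≟ i ⌋ then -[1+ 0 ] else + 2) else δℤ j k
S⊥ℤ i j k = if ⌊ k FinP.≟ i ⌋ then (if ⌊ j FinP.≟ i ⌋ then -[1+ 0 ] else + 2) else δℤ j k

module Descartes {c ℓ₁ ℓ₂} (F : OrderedField c ℓ₁ ℓ₂) where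
  open OrderedField F hiding (zero)
  open OF F
  open IsTotalOrder isTotalOrder using (total; antisym)
    renaming (trans to ≤-trans; reflexive to ≤-reflexive; ≲-respˡ-≈ to ≤-respˡ-≈; ≲-respʳ-≈ to ≤-respʳ-≈)
  open IntegerRingSolver commutativeRing
  open import Algebra.Properties.CommutativeMonoid.Sum +-commutativeMonoid using (sum; sum-permute)
  open import Relation.Binary.Reasoning.Setoid setoid

  ≤-fromDifference : ∀ {x y e} → 0# ≤ e → e ≈ y - x → x ≤ y
  ≤-fromDifference {x} {y} 0≤e e≈y-x =
    ≤-respˡ-≈ (+-identityˡ x) (≤-respʳ-≈ y-x+x≈y (+-monoˡ-≤ x (≤-respʳ-≈ e≈y-x 0≤e)))
    where
    y-x+x≈y : y - x + x ≈ y
    y-x+x≈y = solve 2 (λ x y → y :- x :+ x := y) refl x y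

  ≤⇒0≤difference : ∀ {x y} → x ≤ y → 0# ≤ (y - x)
  ≤⇒0≤difference {x} {y} x≤y = ≤-respˡ-≈ (-‿inverseʳ x) (+-monoˡ-≤ (- x) x≤y)

  0≤x⇒-x≤0 : ∀ {x} → 0# ≤ x → (- x) ≤ 0#
  0≤x⇒-x≤0 {x} 0≤x = ≤-fromDifference 0≤x (solve 1 (λ x → x := con (+ 0) :- (:- x)) refl x)

  0≤+ : ∀ {x y} → 0# ≤ x → 0# ≤ y → 0# ≤ (x + y)
  0≤+ {x} {y} 0≤x 0≤y = ≤-trans (≤-respʳ-≈ (sym (+-identityˡ y)) 0≤y) (+-monoˡ-≤ y 0≤x)

  +-monoʳ-≤ : ∀ {x y} z → x ≤ y → (z + x) ≤ (z + y)
  +-monoʳ-≤ {x} {y} z x≤y = ≤-respˡ-≈ (+-comm x z) (≤-respʳ-≈ (+-comm y z) (+-monoˡ-≤ z x≤y))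

  0≤x⊎0≤-x : ∀ x → 0# ≤ x ⊎ 0# ≤ (- x)
  0≤x⊎0≤-x x with total 0# x
  ... | inj₁ 0≤x = inj₁ 0≤x
  ... | inj₂ x≤0 = inj₂ (≤-respʳ-≈ (+-identityˡ (- x)) (≤⇒0≤difference x≤0))

  0≤x*x : ∀ x → 0# ≤ (x * x)
  0≤x*x x with 0≤x⊎0≤-x x
  ... | inj₁ 0≤x  = *-nonneg 0≤x 0≤x
  ... | inj₂ 0≤-x = ≤-respʳ-≈ (solve 1 (λ x → (:- x) :* (:- x) := x :* x) refl x) (*-nonneg 0≤-x 0≤-x)

  0≤x+x⇒0≤x : ∀ {x} → 0# ≤ (x + x) → 0# ≤ x
  0≤x+x⇒0≤x {x} 0≤2x with 0≤x⊎0≤-x x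
  ... | inj₁ 0≤x  = 0≤x
  ... | inj₂ 0≤-x = ≤-respʳ-≈ (solve 1 (λ x → x :+ x :- x := x) refl x) (0≤+ 0≤2x 0≤-x)

  0≤x*y⇒0≤x : ∀ {x y} → 0# ≤ (x * y) → 0# < y → 0# ≤ x
  0≤x*y⇒0≤x {x} {y} 0≤xy (0≤y , 0≉y) with 0≤x⊎0≤-x x
  ... | inj₁ 0≤x  = 0≤x
  ... | inj₂ 0≤-x = ≤-reflexive (sym x≈0)
    where
    xy≈0 : x * y ≈ 0#
    xy≈0 = antisym (≤-fromDifference (*-nonneg 0≤-x 0≤y)
                      (solve 2 (λ x y → (:- x) :* y := con (+ 0) :- x :* y) refl x y))
                   0≤xy
    x≈0 : x ≈ 0#
    x≈0 = begin
      x               ≈⟨ *-identityʳ x ⟨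
      x * 1#          ≈⟨ *-congˡ (⁻¹-inverse y (λ y≈0 → 0≉y (sym y≈0))) ⟨
      x * (y * y ⁻¹)  ≈⟨ *-assoc x y (y ⁻¹) ⟨
      x * y * y ⁻¹    ≈⟨ *-congʳ xy≈0 ⟩
      0# * y ⁻¹       ≈⟨ zeroˡ (y ⁻¹) ⟩
      0#              ∎

  Σ4-permute : ∀ (σ : Permutation′ 4) f → Σ4 (λ k → f (σ ⟨$⟩ʳ k)) ≈ Σ4 f
  Σ4-permute σ f = begin
    Σ4 (λ k → f (σ ⟨$⟩ʳ k))   ≈⟨ Σ4≈sum (λ k → f (σ ⟨$⟩ʳ k)) ⟩
    sum (λ k → f (σ ⟨$⟩ʳ k))  ≈⟨ sum-permute f σ ⟨
    sum f                     ≈⟨ Σ4≈sum f ⟨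
    Σ4 f                      ∎
    where
    Σ4≈sum : ∀ g → Σ4 g ≈ sum g
    Σ4≈sum g = solve 4 (λ a b c d → a :+ b :+ c :+ d := a :+ (b :+ (c :+ (d :+ con (+ 0)))))
                 refl (g 0F) (g 1F) (g 2F) (g 3F)

  IsDescartes-permute : ∀ (σ : Permutation′ 4) v → IsDescartes v → IsDescartes (λ k → v (σ ⟨$⟩ʳ k))
  IsDescartes-permute σ v D =
    trans (+-cong (*-cong Σ≈ Σ≈) (-‿cong (*-congˡ (Σ4-permute σ (λ k → sq (v k)))))) D
    where
    Σ≈ : Σ4 (λ k → v (σ ⟨$⟩ʳ k)) ≈ Σ4 v
    Σ≈ = Σ4-permute σ v

  descartes-pair-nonneg : ∀ v → IsDescartes v → 0# < Σ4 v → 0# ≤ (v 0F + v 1F)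
  descartes-pair-nonneg v D 0<Σ = 0≤x*y⇒0≤x 0≤αΣ 0<Σ
    where
    p q r s α β A B : Carrier
    p = v 0F ; q = v 1F ; r = v 2F ; s = v 3F
    α = p + q ; β = r + s
    A = p + r - q - s ; B = p + s - q - r
    4αβ≈squares : (α * β + α * β) + (α * β + α * β)
                  ≈ A * A + B * B + 2# * (sq (Σ4 v) - 2# * Σ4 (λ k → sq (v k)))
    4αβ≈squares = solve 4 (λ p q r s →
      ((p :+ q) :* (r :+ s) :+ (p :+ q) :* (r :+ s)) :+ ((p :+ q) :* (r :+ s) :+ (p :+ q) :* (r :+ s))
        := (p :+ r :- q :- s) :* (p :+ r :- q :- s) :+ (p :+ s :- q :- r) :* (p :+ s :- q :- r)
           :+ con (+ 2) :* ((p :+ q :+ r :+ s) :* (p :+ q :+ r :+ s)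
                           :- con (+ 2) :* (p :* p :+ q :* q :+ r :* r :+ s :* s)))
      refl p q r s
    4αβ≈A²+B² : (α * β + α * β) + (α * β + α * β) ≈ A * A + B * B
    4αβ≈A²+B² = trans 4αβ≈squares (trans (+-congˡ (trans (*-congˡ D) (zeroʳ 2#))) (+-identityʳ _))
    0≤αβ : 0# ≤ (α * β)
    0≤αβ = 0≤x+x⇒0≤x (0≤x+x⇒0≤x (≤-respʳ-≈ (sym 4αβ≈A²+B²) (0≤+ (0≤x*x A) (0≤x*x B))))
    0≤αΣ : 0# ≤ (α * Σ4 v)
    0≤αΣ = ≤-respʳ-≈ (solve 4 (λ p q r s → (p :+ q) :* (p :+ q) :+ (p :+ q) :* (r :+ s)
                                          := (p :+ q) :* (p :+ q :+ r :+ s)) refl p q r s)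
             (0≤+ (0≤x*x α) 0≤αβ)

  descartes-pair-nonneg-permute : ∀ v → IsDescartes v → 0# < Σ4 v →
    ∀ (σ : Permutation′ 4) → 0# ≤ (v (σ ⟨$⟩ʳ 0F) + v (σ ⟨$⟩ʳ 1F))
  descartes-pair-nonneg-permute v D (0≤Σ , 0≉Σ) σ =
    descartes-pair-nonneg (λ k → v (σ ⟨$⟩ʳ k)) (IsDescartes-permute σ v D)
      (≤-respʳ-≈ (sym Σ≈) 0≤Σ , λ 0≈Σσ → 0≉Σ (trans 0≈Σσ Σ≈))
    where
    Σ≈ : Σ4 (λ k → v (σ ⟨$⟩ʳ k)) ≈ Σ4 v
    Σ≈ = Σ4-permute σ v

  RootOrdered : Carrier → Carrier → Carrier → Carrier → Set ℓ₂
  RootOrdered a b c d = (a ≤ 0#) × (0# ≤ b) × (b ≤ c) × (c ≤ d) × (d ≤ (a + b + c))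

  RootOrdered-resp-≈ : ∀ {a b c d a′ b′ c′ d′} → a ≈ a′ → b ≈ b′ → c ≈ c′ → d ≈ d′ →
                       RootOrdered a b c d → RootOrdered a′ b′ c′ d′
  RootOrdered-resp-≈ a≈ b≈ c≈ d≈ (a≤0 , 0≤b , b≤c , c≤d , d≤a+b+c) =
    ≤-respˡ-≈ a≈ a≤0 ,
    ≤-respʳ-≈ b≈ 0≤b ,
    ≤-respʳ-≈ c≈ (≤-respˡ-≈ b≈ b≤c) ,
    ≤-respʳ-≈ d≈ (≤-respˡ-≈ c≈ c≤d) ,
    ≤-respʳ-≈ (+-cong (+-cong a≈ b≈) c≈) (≤-respˡ-≈ d≈ d≤a+b+c)

  reflection-rootOrdered : ∀ {x y z w} → y ≤ z → z ≤ w → 0# ≤ (y + z) → 0# ≤ (y + w) → x ≤ w →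
    let X = 2# * (y + z + w) - x in RootOrdered (- X) (2# * X + y) (2# * X + z) (2# * X + w)
  reflection-rootOrdered {x} {y} {z} {w} y≤z z≤w 0≤y+z 0≤y+w x≤w =
    0≤x⇒-x≤0 0≤X , 0≤b , +-monoʳ-≤ (2# * X) y≤z , +-monoʳ-≤ (2# * X) z≤w ,
    ≤-fromDifference 0≤E (solve 4 (λ x y z w → E′ x y z w
      := :- X′ x y z w :+ (con (+ 2) :* X′ x y z w :+ y) :+ (con (+ 2) :* X′ x y z w :+ z)
         :- (con (+ 2) :* X′ x y z w :+ w)) refl x y z w)
    where
    X : Carrier
    X = 2# * (y + z + w) - x
    X′ E′ : ∀ {n} → Polynomial n → Polynomial n → Polynomial n → Polynomial n → Polynomial n
    X′ x y z w = con (+ 2) :* (y :+ z :+ w) :- x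
    E′ x y z w = X′ x y z w :+ y :+ z :- w
    0≤w-x : 0# ≤ (w - x)
    0≤w-x = ≤⇒0≤difference x≤w
    0≤w : 0# ≤ w
    0≤w = 0≤x+x⇒0≤x (≤-respʳ-≈ (solve 2 (λ y w → (y :+ w) :+ (w :- y) := w :+ w) refl y w)
                       (0≤+ 0≤y+w (≤⇒0≤difference (≤-trans y≤z z≤w))))
    0≤X : 0# ≤ X
    0≤X = ≤-respʳ-≈ (solve 4 (λ x y z w → (y :+ z) :+ (y :+ z) :+ (w :- x) :+ w := X′ x y z w) refl x y z w)
            (0≤+ (0≤+ (0≤+ 0≤y+z 0≤y+z) 0≤w-x) 0≤w)
    0≤E : 0# ≤ (X + y + z - w)
    0≤E = ≤-respʳ-≈ (solve 4 (λ x y z w → (y :+ z) :+ (y :+ z) :+ (y :+ z) :+ (w :- x) := E′ x y z w)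
                       refl x y z w)
            (0≤+ (0≤+ (0≤+ 0≤y+z 0≤y+z) 0≤y+z) 0≤w-x)
    0≤b : 0# ≤ (2# * X + y)
    0≤b = ≤-respʳ-≈ (solve 4 (λ x y z w → E′ x y z w :+ X′ x y z w :+ (w :- z) := con (+ 2) :* X′ x y z w :+ y)
                       refl x y z w)
            (0≤+ (0≤+ 0≤E 0≤X) (≤⇒0≤difference z≤w))

  reflect : Fin 4 → Vec4 → Carrier
  reflect i v = 2# * (Σ4 v - v i) - v i

  reflect-permute : ∀ (σ : Permutation′ 4) v →
    reflect (σ ⟨$⟩ʳ 0F) v ≈ 2# * (v (σ ⟨$⟩ʳ 1F) + v (σ ⟨$⟩ʳ 2F) + v (σ ⟨$⟩ʳ 3F)) - v (σ ⟨$⟩ʳ 0F)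
  reflect-permute σ v = begin
    2# * (Σ4 v - x) - x           ≈⟨ +-congʳ (*-congˡ (+-congʳ (Σ4-permute σ v))) ⟨
    2# * (x + y + z + w - x) - x  ≈⟨ solve 4 (λ x y z w → con (+ 2) :* (x :+ y :+ z :+ w :- x) :- x
                                              := con (+ 2) :* (y :+ z :+ w) :- x) refl x y z w ⟩
    2# * (y + z + w) - x          ∎
    where
    x y z w : Carrier
    x = v (σ ⟨$⟩ʳ 0F) ; y = v (σ ⟨$⟩ʳ 1F) ; z = v (σ ⟨$⟩ʳ 2F) ; w = v (σ ⟨$⟩ʳ 3F)

  Σ4ₚ : (Fin 4 → Polynomial 4) → Polynomial 4
  Σ4ₚ f = f 0F :+ f 1F :+ f 2F :+ f 3F

  Siiₚ : Fin 4 → Fin 4 → Polynomial 4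
  Siiₚ i j = Σ4ₚ (λ k → Σ4ₚ (λ l → con (S⊥ℤ i j l) :* con (Sℤ i l k)) :* var k)

  reflectₚ : Fin 4 → Polynomial 4
  reflectₚ i = con (+ 2) :* (Σ4ₚ var :- var i) :- var i

  shiftedₚ : Fin 4 → Fin 4 → Polynomial 4
  shiftedₚ i j = con (+ 2) :* reflectₚ i :+ var j

  Sii-⊛-self : ∀ i v → (Sii i ⊛ v) i ≈ - reflect i v
  Sii-⊛-self 0F v = prove (tabulate v) (Siiₚ 0F 0F) (:- reflectₚ 0F) refl
  Sii-⊛-self 1F v = prove (tabulate v) (Siiₚ 1F 1F) (:- reflectₚ 1F) refl
  Sii-⊛-self 2F v = prove (tabulate v) (Siiₚ 2F 2F) (:- reflectₚ 2F) refl
  Sii-⊛-self 3F v = prove (tabulate v) (Siiₚ 3F 3F) (:- reflectₚ 3F) refl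

  Sii-⊛-other : ∀ {i j} v → j ≢ i → (Sii i ⊛ v) j ≈ 2# * reflect i v + v j
  Sii-⊛-other {0F} {0F} v j≢i = ⊥-elim (j≢i ≡.refl)
  Sii-⊛-other {0F} {1F} v _   = prove (tabulate v) (Siiₚ 0F 1F) (shiftedₚ 0F 1F) refl
  Sii-⊛-other {0F} {2F} v _   = prove (tabulate v) (Siiₚ 0F 2F) (shiftedₚ 0F 2F) refl
  Sii-⊛-other {0F} {3F} v _   = prove (tabulate v) (Siiₚ 0F 3F) (shiftedₚ 0F 3F) refl
  Sii-⊛-other {1F} {0F} v _   = prove (tabulate v) (Siiₚ 1F 0F) (shiftedₚ 1F 0F) refl
  Sii-⊛-other {1F} {1F} v j≢i = ⊥-elim (j≢i ≡.refl)
  Sii-⊛-other {1F} {2F} v _   = prove (tabulate v) (Siiₚ 1F 2F) (shiftedₚ 1F 2F) refl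
  Sii-⊛-other {1F} {3F} v _   = prove (tabulate v) (Siiₚ 1F 3F) (shiftedₚ 1F 3F) refl
  Sii-⊛-other {2F} {0F} v _   = prove (tabulate v) (Siiₚ 2F 0F) (shiftedₚ 2F 0F) refl
  Sii-⊛-other {2F} {1F} v _   = prove (tabulate v) (Siiₚ 2F 1F) (shiftedₚ 2F 1F) refl
  Sii-⊛-other {2F} {2F} v j≢i = ⊥-elim (j≢i ≡.refl)
  Sii-⊛-other {2F} {3F} v _   = prove (tabulate v) (Siiₚ 2F 3F) (shiftedₚ 2F 3F) refl
  Sii-⊛-other {3F} {0F} v _   = prove (tabulate v) (Siiₚ 3F 0F) (shiftedₚ 3F 0F) refl
  Sii-⊛-other {3F} {1F} v _   = prove (tabulate v) (Siiₚ 3F 1F) (shiftedₚ 3F 1F) refl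
  Sii-⊛-other {3F} {2F} v _   = prove (tabulate v) (Siiₚ 3F 2F) (shiftedₚ 3F 2F) refl
  Sii-⊛-other {3F} {3F} v j≢i = ⊥-elim (j≢i ≡.refl)

  sortOthers : ∀ (v : Vec4) i → ∃ λ (σ : Permutation′ 4) →
    σ ⟨$⟩ʳ 0F ≡ i × v (σ ⟨$⟩ʳ 1F) ≤ v (σ ⟨$⟩ʳ 2F) × v (σ ⟨$⟩ʳ 2F) ≤ v (σ ⟨$⟩ʳ 3F)
  sortOthers v i with sort₃ total (λ k → v (transpose 0F i ⟨$⟩ʳ suc k))
  ... | ρ , y≤z , z≤w = lift₀ ρ ∘ₚ transpose 0F i , ≡.refl , y≤z , z≤w

  permute-suc≢permute-0 : ∀ (σ : Permutation′ 4) k → σ ⟨$⟩ʳ suc k ≢ σ ⟨$⟩ʳ 0F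
  permute-suc≢permute-0 σ k eq with ≡.trans (≡.sym (inverseˡ σ)) (≡.trans (≡.cong (σ ⟨$⟩ˡ_) eq) (inverseˡ σ))
  ... | ()

  nonmaximal≤max : ∀ (σ : Permutation′ 4) (v : Vec4) {j} →
    v (σ ⟨$⟩ʳ 1F) ≤ v (σ ⟨$⟩ʳ 2F) → v (σ ⟨$⟩ʳ 2F) ≤ v (σ ⟨$⟩ʳ 3F) →
    v (σ ⟨$⟩ʳ 0F) < v j → v (σ ⟨$⟩ʳ 0F) ≤ v (σ ⟨$⟩ʳ 3F)
  nonmaximal≤max σ v {j} y≤z z≤w x<vj with σ ⟨$⟩ˡ j | inverseʳ σ {j}
  ... | 0F | ≡.refl = ⊥-elim (proj₂ x<vj refl)
  ... | 1F | ≡.refl = ≤-trans (proj₁ x<vj) (≤-trans y≤z z≤w)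
  ... | 2F | ≡.refl = ≤-trans (proj₁ x<vj) z≤w
  ... | 3F | ≡.refl = proj₁ x<vj

mainTheorem10 : ∀ {c ℓ₁ ℓ₂} (F : OrderedField c ℓ₁ ℓ₂) →
    let open OrderedField F
        open OF F
    in (v : Vec4) → IsDescartes v → 0# < Σ4 v →
       (i : Fin 4) → (∃ λ j → v i < v j) →
       IsRoot (Sii i ⊛ v)
mainTheorem10 F v D 0<Σ i (j , vi<vj) with Descartes.sortOthers F v i
... | σ , ≡.refl , y≤z , z≤w =
  σ , RootOrdered-resp-≈ pivot (shifted 0F) (shifted 1F) (shifted 2F)
        (reflection-rootOrdered y≤z z≤w 0≤y+z 0≤y+w (nonmaximal≤max σ v y≤z z≤w vi<vj))
  where
  open OrderedField F hiding (zero)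
  open OF F
  open Descartes F
  X : Carrier
  X = 2# * (v (σ ⟨$⟩ʳ 1F) + v (σ ⟨$⟩ʳ 2F) + v (σ ⟨$⟩ʳ 3F)) - v (σ ⟨$⟩ʳ 0F)
  pivot : - X ≈ (Sii (σ ⟨$⟩ʳ 0F) ⊛ v) (σ ⟨$⟩ʳ 0F)
  pivot = sym (trans (Sii-⊛-self _ v) (-‿cong (reflect-permute σ v)))
  shifted : ∀ k → 2# * X + v (σ ⟨$⟩ʳ suc k) ≈ (Sii (σ ⟨$⟩ʳ 0F) ⊛ v) (σ ⟨$⟩ʳ suc k)
  shifted k = sym (trans (Sii-⊛-other v (permute-suc≢permute-0 σ k)) (+-congʳ (*-congˡ (reflect-permute σ v))))
  0≤y+z : 0# ≤ (v (σ ⟨$⟩ʳ 1F) + v (σ ⟨$⟩ʳ 2F))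
  0≤y+z = descartes-pair-nonneg-permute v D 0<Σ (transpose 1F 2F ∘ₚ transpose 0F 1F ∘ₚ σ)
  0≤y+w : 0# ≤ (v (σ ⟨$⟩ʳ 1F) + v (σ ⟨$⟩ʳ 3F))
  0≤y+w = descartes-pair-nonneg-permute v D 0<Σ (transpose 1F 3F ∘ₚ transpose 0F 1F ∘ₚ σ)
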